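{- Let $U=\{(e_1,\ldots,e_8)\in E^8 : e_i\cdot e_j=1 \text{ for all } i\neq j\}$. Every element of $U$ generates (as a $\mathbb{Z}$-module) a sublattice of index $3$ in $\Lambda$, and the group $W$ acts freely on $U$.
   Context: $\Lambda=\{a\in \mathbb{Z}^8+\langle(\tfrac12,\ldots,\tfrac12)\rangle : \sum_i a_i\in 2\mathbb{Z}\}$ is the $E_8$ lattice, $E=\{a\in\Lambda:\|a\|=\sqrt2\}$ its root system, and $W$ the Weyl group of $E_8$ (equal to the automorphism group of $\Lambda$), acting componentwise. -}

module Defs where

open import Data.Nat using (ℕ)
open import Data.Integer using (ℤ; +_; _+_; _*_; _-_)
open import Data.Integer.Divisibility using (_∣_)
open import Data.Fin using (Fin)
open import Data.Vec using (Vec; lookup; zipWith; foldr′; replicate; map; tabulate)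
open import Data.Product using (Σ; ∃; _×_)
open import Data.Sum using (_⊎_)
open import Relation.Binary.PropositionalEquality using (_≡_; _≢_)

-- CONVENTION: a vector a ∈ ℚ^8 is represented by its DOUBLE x = 2a ∈ ℤ^8.
-- (Every element of Λ has coordinates in ½ℤ, so this is a bijection onto
-- the image.)  Hence the true inner product a·b equals (dot x y)/4.
V : Set
V = Vec ℤ 8

_+ᵥ_ : V → V → V
_+ᵥ_ = zipWith _+_

_-ᵥ_ : V → V → V
_-ᵥ_ = zipWith _-_

0ᵥ : V
0ᵥ = replicate 8 (+ 0)

_·ᵥ_ : ℤ → V → V
c ·ᵥ v = map (c *_) v

sumV : V → ℤ
sumV = foldr′ _+_ (+ 0)

dot : V → V → ℤ
dot x y = sumV (zipWith _*_ x y)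

-- a = x/2 ∈ Λ  iff  (a ∈ ℤ^8 or a ∈ ℤ^8 + (½,…,½)) and Σ aᵢ ∈ 2ℤ
--             iff  (all xᵢ even or all xᵢ odd) and 4 ∣ Σ xᵢ
InΛ : V → Set
InΛ x = (((i : Fin 8) → + 2 ∣ lookup x i) ⊎ ((i : Fin 8) → + 2 ∣ (lookup x i + + 1)))
        × (+ 4 ∣ sumV x)

-- E : roots, ‖a‖ = √2, i.e. a·a = 2, i.e. dot x x = 8
InE : V → Set
InE x = InΛ x × dot x x ≡ + 8

InU : (Fin 8 → V) → Set
InU e = ((i : Fin 8) → InE (e i)) × ((i j : Fin 8) → i ≢ j → dot (e i) (e j) ≡ + 4)

lincomb : (Fin 8 → ℤ) → (Fin 8 → V) → V
lincomb c e = foldr′ _+ᵥ_ 0ᵥ (tabulate (λ i → c i ·ᵥ e i))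

Span : (Fin 8 → V) → V → Set
Span e x = Σ (Fin 8 → ℤ) (λ c → x ≡ lincomb c e)

-- L is a subset of Λ (L is assumed to be a subgroup, e.g. a span)
SubsetΛ : (V → Set) → Set
SubsetΛ L = (x : V) → L x → InΛ x

-- [Λ : L] = n : there is a transversal r₁,…,rₙ ∈ Λ of Λ/L,
-- i.e. every x ∈ Λ is ≡ some rᵢ mod L and the rᵢ are pairwise incongruent.
HasIndex : (V → Set) → ℕ → Set
HasIndex L n =
  Σ (Fin n → V) (λ r →
      ((i : Fin n) → InΛ (r i))
    × ((x : V) → InΛ x → ∃ (λ i → L (x -ᵥ r i)))
    × ((i j : Fin n) → L (r i -ᵥ r j) → i ≡ j))

-- W = Aut(Λ): bijections of Λ that are additive (hence ℤ-linear) and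
-- preserve the inner product.  Only the values on Λ matter.
record Aut : Set where
  field
    f     : V → V
    pres  : (x : V) → InΛ x → InΛ (f x)
    add   : (x y : V) → InΛ x → InΛ y → f (x +ᵥ y) ≡ f x +ᵥ f y
    isom  : (x y : V) → InΛ x → InΛ y → dot (f x) (f y) ≡ dot x y
    surj  : (y : V) → InΛ y → ∃ (λ x → InΛ x × f x ≡ y)
open Aut public

Fixes : Aut → (Fin 8 → V) → Set
Fixes g e = (i : Fin 8) → f g (e i) ≡ e i

IsId : Aut → Set
IsId g = (x : V) → InΛ x → f g x ≡ x

module Submission where

-- The Gram matrix of e ∈ U is I + J, which is nondegenerate; since
-- any 9 vectors of ℤ⁸ are linearly dependent (Steinitz), a vector is
-- determined by its inner products with e₁,…,e₈.  Freeness follows at once: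
-- if g fixes every eⱼ then g x·eⱼ = g x·g eⱼ = x·eⱼ, so g x = x.  Inverting
-- the Gram matrix gives 36x = Σⱼ (9 x·eⱼ − Σᵢ x·eᵢ) eⱼ; applied to the
-- standard basis vectors it shows that 3 divides every coordinate of
-- S = e₁ + ⋯ + e₈, so T = S/3 lies in Λ (as 3T does), with eⱼ·T = 3 and
-- T·T = 8.  Since Λ is integral, each x ∈ Λ is congruent to one of 0, T, 2T
-- modulo the span L of e, and since 3 ∤ 8 no multiple dT with 0 < |d| < 3
-- lies in L; thus 0, T, 2T is a transversal of Λ/L.
--
-- Vectors are stored doubled, as in Defs, so dot x y = 4 a·b.

open import Defs
import Algebra.Properties.Semiring.Sum as Sum
open import Data.Empty using (⊥-elim)
open import Data.Fin using (Fin; zero; suc; punchIn; toℕ; fromℕ<)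
open import Data.Fin.Properties using (any?; punchInᵢ≢i; toℕ-fromℕ<)
open import Data.Integer as ℤ using (ℤ; +_; -_; _+_; _*_; _-_; -[1+_])
import Data.Integer.DivMod as DM
open import Data.Integer.Divisibility.Signed
  using (_∣_; divides; quotient; ∣ᵤ⇒∣; ∣⇒∣ᵤ; ∣m∣n⇒∣m+n; ∣m∣n⇒∣m-n; ∣n⇒∣m*n)
import Data.Integer.Properties as ℤP
open import Data.Integer.Tactic.RingSolver using (solve-∀)
open import Data.Nat as ℕ using (ℕ)
import Data.Nat.Divisibility as ℕ∣
open import Data.Nat.Primality using (Prime; prime?; euclidsLemma)
open import Data.Product using (_×_; _,_; Σ; ∃; proj₁; proj₂)
open import Data.Sum using (_⊎_; inj₁; inj₂)
open import Data.Vec using (Vec; []; _∷_; lookup; zipWith; foldr′; tabulate)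
import Data.Vec.Properties as VecP
open import Data.Vec.Functional using (insertAt)
open import Data.Vec.Functional.Properties using (insertAt-lookup; insertAt-punchIn)
open import Function using (_∘_)
open import Relation.Binary.PropositionalEquality
open import Relation.Nullary using (yes; no; ¬?)
open import Relation.Nullary.Decidable using (toWitness)

open Sum ℤP.+-*-semiring
  using (sum; sum-syntax; sum-cong-≗; ∑-distrib-+; ∑-comm; sum-remove;
         *-distribˡ-sum; *-distribʳ-sum; sum-replicate-zero)

sum-zero : ∀ n → ∑[ i < n ] (+ 0) ≡ + 0
sum-zero n = sum-replicate-zero n

sum-const : ∀ {n} c → ∑[ i < n ] c ≡ + n * c
sum-const {ℕ.zero} c = sym (ℤP.*-zeroˡ c)
sum-const {ℕ.suc n} c = trans (cong (_+_ c) (sum-const {n} c)) (step (+ n) c)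
  where step : ∀ m c → c + m * c ≡ (+ 1 + m) * c
        step = solve-∀

sum-*ʳ : ∀ {n} c (f : Fin n → ℤ) → ∑[ i < n ] (f i * c) ≡ sum f * c
sum-*ʳ c f = sym (*-distribʳ-sum c f)

sum-*ˡ : ∀ {n} c (f : Fin n → ℤ) → ∑[ i < n ] (c * f i) ≡ c * sum f
sum-*ˡ c f = sym (*-distribˡ-sum c f)

sum-neg : ∀ {n} (f : Fin n → ℤ) → ∑[ i < n ] (- f i) ≡ - sum f
sum-neg f = trans (sum-cong-≗ (λ i → sym (ℤP.-1*i≡-i (f i)))) (trans (sum-*ˡ (- + 1) f) (ℤP.-1*i≡-i (sum f)))

sum-- : ∀ {n} (f g : Fin n → ℤ) → ∑[ i < n ] (f i - g i) ≡ sum f - sum g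
sum-- f g = trans (∑-distrib-+ f (λ i → - g i)) (cong (_+_ (sum f)) (sum-neg g))

∣-sum : ∀ {n} {k} (f : Fin n → ℤ) → (∀ i → k ∣ f i) → k ∣ sum f
∣-sum {ℕ.zero} f _ = divides (+ 0) refl
∣-sum {ℕ.suc n} f d = ∣m∣n⇒∣m+n (d zero) (∣-sum (f ∘ suc) (d ∘ suc))

prime-3 : Prime 3
prime-3 = toWitness {a? = prime? 3} _

prime∣square⇒prime∣ : ∀ {p} → Prime p → ∀ s → + p ∣ s * s → + p ∣ s
prime∣square⇒prime∣ {p} p-prime s p∣s²
  with euclidsLemma ℤ.∣ s ∣ ℤ.∣ s ∣ p-prime (subst (p ℕ∣.∣_) (ℤP.abs-* s s) (∣⇒∣ᵤ p∣s²))
... | inj₁ p∣s = ∣ᵤ⇒∣ p∣s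
... | inj₂ p∣s = ∣ᵤ⇒∣ p∣s

parity : ∀ ε → + 2 ∣ ε ⊎ + 2 ∣ ε + + 1
parity ε = classify (ε DM.% + 2) (ε DM./ + 2) (DM.a≡a%n+[a/n]*n ε (+ 2)) (DM.n%d<d ε (+ 2))
  where
    classify : ∀ r k → ε ≡ + r + k * + 2 → r ℕ.< 2 → + 2 ∣ ε ⊎ + 2 ∣ ε + + 1
    classify 0 k ε≡2k _ = inj₁ (divides k (trans ε≡2k (ℤP.+-identityˡ _)))
    classify 1 k ε≡2k+1 _ = inj₂ (divides (k + + 1) (trans (cong (_+ + 1) ε≡2k+1) (shift k)))
      where shift : ∀ k → + 1 + k * + 2 + + 1 ≡ (k + + 1) * + 2
            shift = solve-∀
    classify (ℕ.suc (ℕ.suc r)) k _ (ℕ.s≤s (ℕ.s≤s ()))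

complement-mod : ∀ q d .{{_ : ℕ.NonZero d}} → Σ (Fin d) λ i → + d ∣ q + + toℕ i
complement-mod q d = fromℕ< r<d , divides (- k) (begin
  q + + toℕ (fromℕ< r<d)   ≡⟨ cong (λ t → q + + t) (toℕ-fromℕ< r<d) ⟩
  q + + r                  ≡⟨ rearrange q (+ r) k (+ d) ⟩
  q + (+ r + k * + d) - k * + d ≡⟨ cong (λ t → q + t - k * + d) (sym (DM.a≡a%ℕn+[a/ℕn]*n (- q) d)) ⟩
  q + - q - k * + d        ≡⟨ cancel q k (+ d) ⟩
  - k * + d                ∎)
  where
    open ≡-Reasoning
    r : ℕ
    r = (- q) DM.%ℕ d
    k : ℤ
    k = (- q) DM./ℕ d
    r<d : r ℕ.< d
    r<d = DM.n%ℕd<d (- q) d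
    rearrange : ∀ q r k d → q + r ≡ q + (r + k * d) - k * d
    rearrange = solve-∀
    cancel : ∀ q k d → q + - q - k * d ≡ - k * d
    cancel = solve-∀

incongruent-mod-3 : (i j : Fin 3) → + 3 ∣ + toℕ i - + toℕ j → i ≡ j
incongruent-mod-3 zero zero _ = refl
incongruent-mod-3 (suc zero) (suc zero) _ = refl
incongruent-mod-3 (suc (suc zero)) (suc (suc zero)) _ = refl
incongruent-mod-3 zero (suc zero) 3∣d = ⊥-elim (ℕ∣.>⇒∤ (ℕ.s≤s (ℕ.s≤s ℕ.z≤n)) (∣⇒∣ᵤ 3∣d))
incongruent-mod-3 zero (suc (suc zero)) 3∣d = ⊥-elim (ℕ∣.>⇒∤ (ℕ.s≤s (ℕ.s≤s (ℕ.s≤s ℕ.z≤n))) (∣⇒∣ᵤ 3∣d))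
incongruent-mod-3 (suc zero) zero 3∣d = ⊥-elim (ℕ∣.>⇒∤ (ℕ.s≤s (ℕ.s≤s ℕ.z≤n)) (∣⇒∣ᵤ 3∣d))
incongruent-mod-3 (suc zero) (suc (suc zero)) 3∣d = ⊥-elim (ℕ∣.>⇒∤ (ℕ.s≤s (ℕ.s≤s ℕ.z≤n)) (∣⇒∣ᵤ 3∣d))
incongruent-mod-3 (suc (suc zero)) zero 3∣d = ⊥-elim (ℕ∣.>⇒∤ (ℕ.s≤s (ℕ.s≤s (ℕ.s≤s ℕ.z≤n))) (∣⇒∣ᵤ 3∣d))
incongruent-mod-3 (suc (suc zero)) (suc zero) 3∣d = ⊥-elim (ℕ∣.>⇒∤ (ℕ.s≤s (ℕ.s≤s ℕ.z≤n)) (∣⇒∣ᵤ 3∣d))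

⟨_,_⟩ : ∀ {n} → (Fin n → ℤ) → (Fin n → ℤ) → ℤ
⟨ x , y ⟩ = ∑[ k < _ ] (x k * y k)

combination : ∀ {m n} → (Fin m → ℤ) → (Fin m → Fin n → ℤ) → Fin n → ℤ
combination {m} c w k = ∑[ i < m ] (c i * w i k)

⟨combination⟩ : ∀ {m n} (c : Fin m → ℤ) (w : Fin m → Fin n → ℤ) (y : Fin n → ℤ) →
  ⟨ combination c w , y ⟩ ≡ ∑[ i < m ] (c i * ⟨ w i , y ⟩)
⟨combination⟩ {m} {n} c w y = begin
  ∑[ k < n ] (∑[ i < m ] (c i * w i k) * y k)   ≡⟨ sum-cong-≗ (λ k → sym (sum-*ʳ (y k) (λ i → c i * w i k))) ⟩
  ∑[ k < n ] ∑[ i < m ] (c i * w i k * y k)     ≡⟨ sym (∑-comm (λ i k → c i * w i k * y k)) ⟩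
  ∑[ i < m ] ∑[ k < n ] (c i * w i k * y k)     ≡⟨ sum-cong-≗ (λ i → trans (sum-cong-≗ (λ k → ℤP.*-assoc (c i) (w i k) (y k)))
                                                                           (sum-*ˡ (c i) (λ k → w i k * y k))) ⟩
  ∑[ i < m ] (c i * ⟨ w i , y ⟩)               ∎
  where open ≡-Reasoning

Nontrivial : ∀ {m} → (Fin m → ℤ) → Set
Nontrivial c = ∃ λ i → c i ≢ + 0

Dependent : ∀ {m n} → (Fin m → Fin n → ℤ) → Set
Dependent w = Σ _ λ c → Nontrivial c × (∀ k → combination c w k ≡ + 0)

dependent-zero-column : ∀ {m n} (w : Fin (ℕ.suc m) → Fin (ℕ.suc n) → ℤ) →
  (∀ i → w i zero ≡ + 0) → Dependent (λ i k → w (suc i) (suc k)) → Dependent w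
dependent-zero-column {m} w w₀≡0 (d , (i , dᵢ≢0) , rel) = c , (suc i , dᵢ≢0) , rel′
  where
    c : Fin (ℕ.suc m) → ℤ
    c zero = + 0
    c (suc i) = d i
    rel′ : ∀ k → combination c w k ≡ + 0
    rel′ zero = trans (cong (_+_ (+ 0 * w zero zero))
                        (trans (sum-cong-≗ (λ i → trans (cong (d i *_) (w₀≡0 (suc i))) (ℤP.*-zeroʳ (d i))))
                               (sum-zero m)))
                      (ℤP.*-zeroˡ (w zero zero))
    rel′ (suc k) = trans (cong (_+_ (+ 0 * w zero (suc k))) (rel k)) (ℤP.*-zeroˡ (w zero (suc k)))

-- Gaussian elimination at a pivot wₚ₀: the rows a·w_{p̂ i} − w_{p̂ i,0}·wₚ
-- (a = wₚ₀, p̂ i ranging over the other rows) have vanishing first column,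
-- which is dropped.
eliminated : ∀ {m n} → (Fin (ℕ.suc m) → Fin (ℕ.suc n) → ℤ) → Fin (ℕ.suc m) → Fin m → Fin n → ℤ
eliminated w p i k = w p zero * w (punchIn p i) (suc k) - w (punchIn p i) zero * w p (suc k)

-- If wₚ₀ = a ≠ 0, a relation d among the eliminated rows lifts to the
-- relation with coefficients a·dᵢ at row p̂ i and −Σ dᵢw_{p̂ i,0} at row p.
dependent-pivot : ∀ {m n} (w : Fin (ℕ.suc m) → Fin (ℕ.suc n) → ℤ) (p : Fin (ℕ.suc m)) →
  w p zero ≢ + 0 → Dependent (eliminated w p) → Dependent w
dependent-pivot {m} {n} w p a≢0 (d , (i , dᵢ≢0) , rel) = c , (punchIn p i , cᵢ≢0) , rel′
  where
    a : ℤ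
    a = w p zero
    y : Fin (ℕ.suc n) → ℤ
    y = combination d (λ i → w (punchIn p i))
    c : Fin (ℕ.suc m) → ℤ
    c = insertAt (λ i → a * d i) p (- y zero)
    cᵢ≢0 : c (punchIn p i) ≢ + 0
    cᵢ≢0 cᵢ≡0 with ℤP.i*j≡0⇒i≡0∨j≡0 a (trans (sym (insertAt-punchIn (λ i → a * d i) p (- y zero) i)) cᵢ≡0)
    ... | inj₁ a≡0 = a≢0 a≡0
    ... | inj₂ dᵢ≡0 = dᵢ≢0 dᵢ≡0
    split : ∀ k → combination c w k ≡ - y zero * w p k + a * y k
    split k = begin
      combination c w k
        ≡⟨ sum-remove {i = p} (λ j → c j * w j k) ⟩
      c p * w p k + ∑[ i < m ] (c (punchIn p i) * w (punchIn p i) k)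
        ≡⟨ cong₂ _+_ (cong (_* w p k) (insertAt-lookup (λ i → a * d i) p (- y zero)))
                     (sum-cong-≗ (λ i → trans (cong (_* w (punchIn p i) k) (insertAt-punchIn (λ i → a * d i) p (- y zero) i))
                                             (ℤP.*-assoc a (d i) _))) ⟩
      - y zero * w p k + ∑[ i < m ] (a * (d i * w (punchIn p i) k))
        ≡⟨ cong (_+_ (- y zero * w p k)) (sum-*ˡ a (λ i → d i * w (punchIn p i) k)) ⟩
      - y zero * w p k + a * y k ∎
      where open ≡-Reasoning
    rel′ : ∀ k → combination c w k ≡ + 0
    rel′ zero = trans (split zero) (cancel (y zero) a)
      where cancel : ∀ x a → - x * a + a * x ≡ + 0
            cancel = solve-∀
    rel′ (suc k) = begin
      combination c w (suc k)                                ≡⟨ split (suc k) ⟩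
      - y zero * b + a * y (suc k)                           ≡⟨ regroup (y zero) b a (y (suc k)) ⟩
      a * y (suc k) - b * y zero                             ≡⟨ cong₂ _-_ (sym (sum-*ˡ a u)) (sym (sum-*ˡ b v)) ⟩
      ∑[ i < m ] (a * u i) - ∑[ i < m ] (b * v i)            ≡⟨ sym (sum-- (λ i → a * u i) (λ i → b * v i)) ⟩
      ∑[ i < m ] (a * u i - b * v i)                         ≡⟨ sum-cong-≗ (λ i → factor (d i) a b _ _) ⟩
      ∑[ i < m ] (d i * eliminated w p i k)                  ≡⟨ rel k ⟩
      + 0                                                    ∎
      where
        open ≡-Reasoning
        b : ℤ
        b = w p (suc k)
        u v : Fin m → ℤ
        u i = d i * w (punchIn p i) (suc k)
        v i = d i * w (punchIn p i) zero
        regroup : ∀ x b a y → - x * b + a * y ≡ a * y - b * x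
        regroup = solve-∀
        factor : ∀ d a b s t → a * (d * s) - b * (d * t) ≡ d * (a * s - t * b)
        factor = solve-∀

steinitz : ∀ n (w : Fin (ℕ.suc n) → Fin n → ℤ) → Dependent w
steinitz ℕ.zero w = (λ _ → + 1) , (zero , λ ()) , λ ()
steinitz (ℕ.suc n) w with any? (λ i → ¬? (w i zero ℤ.≟ + 0))
... | yes (p , a≢0) = dependent-pivot w p a≢0 (steinitz n (eliminated w p))
... | no no-pivot = dependent-zero-column w column-zero (steinitz n (λ i k → w (suc i) (suc k)))
  where
    column-zero : ∀ i → w i zero ≡ + 0
    column-zero i with w i zero ℤ.≟ + 0
    ... | yes eq = eq
    ... | no ne = ⊥-elim (no-pivot (i , ne))

NondegenerateGram : ∀ {n} → (Fin n → Fin n → ℤ) → Set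
NondegenerateGram {n} w = (c : Fin n → ℤ) → (∀ m → ∑[ j < n ] (c j * ⟨ w j , w m ⟩) ≡ + 0) → ∀ j → c j ≡ + 0

-- If n vectors in ℤⁿ have nondegenerate Gram matrix, the only vector
-- orthogonal to all of them is 0: by Steinitz z and the wⱼ satisfy a relation
-- c₀z + Σ cⱼwⱼ = 0; pairing with the wₘ forces all cⱼ = 0, hence c₀ ≠ 0 and z = 0.
orthogonal⇒zero : ∀ {n} (w : Fin n → Fin n → ℤ) → NondegenerateGram w →
  ∀ z → (∀ m → ⟨ z , w m ⟩ ≡ + 0) → ∀ k → z k ≡ + 0
orthogonal⇒zero {n} w nondeg z z⊥w k = from-relation (steinitz n u)
  where
    u : Fin (ℕ.suc n) → Fin n → ℤ
    u zero = z
    u (suc j) = w j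
    from-relation : Dependent u → z k ≡ + 0
    from-relation (c , nontrivial , rel) = z≡0 (ℤP.i*j≡0⇒i≡0∨j≡0 (c zero) c₀zₖ≡0)
      where
        gram-relation : ∀ m → ∑[ j < n ] (c (suc j) * ⟨ w j , w m ⟩) ≡ + 0
        gram-relation m = begin
          ∑[ j < n ] (c (suc j) * ⟨ w j , w m ⟩)
            ≡⟨ sym (ℤP.+-identityˡ _) ⟩
          + 0 + ∑[ j < n ] (c (suc j) * ⟨ w j , w m ⟩)
            ≡⟨ cong (_+ ∑[ j < n ] (c (suc j) * ⟨ w j , w m ⟩)) (sym (trans (cong (c zero *_) (z⊥w m)) (ℤP.*-zeroʳ (c zero)))) ⟩
          ∑[ i < ℕ.suc n ] (c i * ⟨ u i , w m ⟩)
            ≡⟨ sym (⟨combination⟩ c u (w m)) ⟩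
          ⟨ combination c u , w m ⟩
            ≡⟨ sum-cong-≗ (λ l → trans (cong (_* w m l) (rel l)) (ℤP.*-zeroˡ (w m l))) ⟩
          ∑[ l < n ] (+ 0)
            ≡⟨ sum-zero n ⟩
          + 0 ∎
          where open ≡-Reasoning
        c′≡0 : ∀ j → c (suc j) ≡ + 0
        c′≡0 = nondeg (c ∘ suc) gram-relation
        c₀zₖ≡0 : c zero * z k ≡ + 0
        c₀zₖ≡0 = begin
          c zero * z k
            ≡⟨ sym (ℤP.+-identityʳ _) ⟩
          c zero * z k + + 0
            ≡⟨ cong (_+_ (c zero * z k)) (sym (trans (sum-cong-≗ (λ j → trans (cong (_* w j k) (c′≡0 j)) (ℤP.*-zeroˡ (w j k)))) (sum-zero n))) ⟩
          combination c u k
            ≡⟨ rel k ⟩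
          + 0 ∎
          where open ≡-Reasoning
        c₀≢0 : Nontrivial c → c zero ≢ + 0
        c₀≢0 (zero , c₀≢0) = c₀≢0
        c₀≢0 (suc j , cⱼ≢0) = ⊥-elim (cⱼ≢0 (c′≡0 j))
        z≡0 : c zero ≡ + 0 ⊎ z k ≡ + 0 → z k ≡ + 0
        z≡0 (inj₁ c₀≡0) = ⊥-elim (c₀≢0 nontrivial c₀≡0)
        z≡0 (inj₂ zₖ≡0) = zₖ≡0

⟨basis⟩ : ∀ {n} (a : Fin (ℕ.suc n)) (y : Fin (ℕ.suc n) → ℤ) →
  ⟨ insertAt (λ _ → + 0) a (+ 1) , y ⟩ ≡ y a
⟨basis⟩ {n} a y = begin
  ⟨ δ , y ⟩                                    ≡⟨ sum-remove {i = a} (λ k → δ k * y k) ⟩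
  δ a * y a + ∑[ i < n ] (δ (punchIn a i) * y (punchIn a i))
    ≡⟨ cong₂ _+_ (cong (_* y a) (insertAt-lookup (λ _ → + 0) a (+ 1)))
                 (trans (sum-cong-≗ (λ i → trans (cong (_* y (punchIn a i)) (insertAt-punchIn (λ _ → + 0) a (+ 1) i))
                                                 (ℤP.*-zeroˡ (y (punchIn a i)))))
                        (sum-zero n)) ⟩
  + 1 * y a + + 0                              ≡⟨ trans (ℤP.+-identityʳ _) (ℤP.*-identityˡ (y a)) ⟩
  y a                                          ∎
  where
    open ≡-Reasoning
    δ : Fin (ℕ.suc n) → ℤ
    δ = insertAt (λ _ → + 0) a (+ 1)

-- I + J is nondegenerate over ℤ: if Σc + cₘ = 0 for all m, then summing over m
-- gives (n + 1)·Σc = 0, so Σc = 0 and hence every cₘ = 0.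
I+J-nondegenerate : ∀ {n} (c : Fin n → ℤ) → (∀ m → sum c + c m ≡ + 0) → ∀ m → c m ≡ + 0
I+J-nondegenerate {n} c h m = trans (sym (ℤP.+-identityˡ (c m))) (trans (cong (_+ c m) (sym Σc≡0)) (h m))
  where
    Σc≡0 : sum c ≡ + 0
    Σc≡0 with ℤP.i*j≡0⇒i≡0∨j≡0 (+ ℕ.suc n) {sum c} (begin
      + ℕ.suc n * sum c                  ≡⟨ ℤP.*-distribʳ-+ (sum c) (+ 1) (+ n) ⟩
      + 1 * sum c + + n * sum c          ≡⟨ cong₂ _+_ (ℤP.*-identityˡ (sum c)) (sym (sum-const {n} (sum c))) ⟩
      sum c + ∑[ m < n ] (sum c)         ≡⟨ ℤP.+-comm (sum c) _ ⟩
      ∑[ m < n ] (sum c) + sum c         ≡⟨ sym (∑-distrib-+ (λ _ → sum c) c) ⟩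
      ∑[ m < n ] (sum c + c m)           ≡⟨ sum-cong-≗ h ⟩
      ∑[ m < n ] (+ 0)                   ≡⟨ sum-zero n ⟩
      + 0                                ∎)
      where open ≡-Reasoning
    ... | inj₁ ()
    ... | inj₂ Σc≡0 = Σc≡0

vext : ∀ {n} {x y : Vec ℤ n} → (∀ i → lookup x i ≡ lookup y i) → x ≡ y
vext {x = x} {y} x≗y = trans (sym (VecP.tabulate∘lookup x)) (trans (VecP.tabulate-cong x≗y) (VecP.tabulate∘lookup y))

lookup-+ᵥ : ∀ (x y : V) i → lookup (x +ᵥ y) i ≡ lookup x i + lookup y i
lookup-+ᵥ x y i = VecP.lookup-zipWith _+_ i x y

lookup--ᵥ : ∀ (x y : V) i → lookup (x -ᵥ y) i ≡ lookup x i - lookup y i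
lookup--ᵥ x y i = VecP.lookup-zipWith _-_ i x y

lookup-·ᵥ : ∀ c (x : V) i → lookup (c ·ᵥ x) i ≡ c * lookup x i
lookup-·ᵥ c x i = VecP.lookup-map i (c *_) x

lookup-0ᵥ : ∀ i → lookup 0ᵥ i ≡ + 0
lookup-0ᵥ i = VecP.lookup-replicate i (+ 0)

foldr′-sum : ∀ {n} (x : Vec ℤ n) → foldr′ _+_ (+ 0) x ≡ sum (lookup x)
foldr′-sum [] = refl
foldr′-sum (a ∷ x) = cong (_+_ a) (foldr′-sum x)

dot-⟨⟩ : ∀ (x y : V) → dot x y ≡ ⟨ lookup x , lookup y ⟩
dot-⟨⟩ x y = trans (foldr′-sum (zipWith _*_ x y)) (sum-cong-≗ (λ k → VecP.lookup-zipWith _*_ k x y))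

dot-comm : ∀ (x y : V) → dot x y ≡ dot y x
dot-comm x y = trans (dot-⟨⟩ x y) (trans (sum-cong-≗ (λ k → ℤP.*-comm (lookup x k) (lookup y k))) (sym (dot-⟨⟩ y x)))

lookup-lincomb : ∀ c e k → lookup (lincomb c e) k ≡ combination c (lookup ∘ e) k
lookup-lincomb c e k = trans (lookup-foldr (λ i → c i ·ᵥ e i)) (sum-cong-≗ (λ j → lookup-·ᵥ (c j) (e j) k))
  where
    lookup-foldr : ∀ {m} (g : Fin m → V) → lookup (foldr′ _+ᵥ_ 0ᵥ (tabulate g)) k ≡ ∑[ j < m ] lookup (g j) k
    lookup-foldr {ℕ.zero} g = lookup-0ᵥ k
    lookup-foldr {ℕ.suc m} g = trans (lookup-+ᵥ (g zero) _ k) (cong (_+_ (lookup (g zero) k)) (lookup-foldr (g ∘ suc)))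

dot-lincomb : ∀ c e (y : V) → dot (lincomb c e) y ≡ ∑[ j < 8 ] (c j * dot (e j) y)
dot-lincomb c e y = begin
  dot (lincomb c e) y                                 ≡⟨ dot-⟨⟩ (lincomb c e) y ⟩
  ⟨ lookup (lincomb c e) , lookup y ⟩                 ≡⟨ sum-cong-≗ (λ k → cong (_* lookup y k) (lookup-lincomb c e k)) ⟩
  ⟨ combination c (lookup ∘ e) , lookup y ⟩           ≡⟨ ⟨combination⟩ c (lookup ∘ e) (lookup y) ⟩
  ∑[ j < 8 ] (c j * ⟨ lookup (e j) , lookup y ⟩)      ≡⟨ sum-cong-≗ (λ j → cong (c j *_) (sym (dot-⟨⟩ (e j) y))) ⟩
  ∑[ j < 8 ] (c j * dot (e j) y)                      ∎
  where open ≡-Reasoning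

dot-·ᵥ : ∀ c (x y : V) → dot (c ·ᵥ x) y ≡ c * dot x y
dot-·ᵥ c x y = begin
  dot (c ·ᵥ x) y                          ≡⟨ dot-⟨⟩ (c ·ᵥ x) y ⟩
  ∑[ k < 8 ] (lookup (c ·ᵥ x) k * lookup y k) ≡⟨ sum-cong-≗ (λ k → trans (cong (_* lookup y k) (lookup-·ᵥ c x k)) (ℤP.*-assoc c _ _)) ⟩
  ∑[ k < 8 ] (c * (lookup x k * lookup y k))  ≡⟨ sum-*ˡ c (λ k → lookup x k * lookup y k) ⟩
  c * ⟨ lookup x , lookup y ⟩              ≡⟨ cong (c *_) (sym (dot-⟨⟩ x y)) ⟩
  c * dot x y                             ∎
  where open ≡-Reasoning

dot--ᵥ : ∀ (x y z : V) → dot (x -ᵥ y) z ≡ dot x z - dot y z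
dot--ᵥ x y z = begin
  dot (x -ᵥ y) z                                       ≡⟨ dot-⟨⟩ (x -ᵥ y) z ⟩
  ∑[ k < 8 ] (lookup (x -ᵥ y) k * lookup z k)          ≡⟨ sum-cong-≗ (λ k → trans (cong (_* lookup z k) (lookup--ᵥ x y k)) (distrib (lookup x k) (lookup y k) (lookup z k))) ⟩
  ∑[ k < 8 ] (lookup x k * lookup z k - lookup y k * lookup z k) ≡⟨ sum-- (λ k → lookup x k * lookup z k) (λ k → lookup y k * lookup z k) ⟩
  ⟨ lookup x , lookup z ⟩ - ⟨ lookup y , lookup z ⟩    ≡⟨ sym (cong₂ _-_ (dot-⟨⟩ x z) (dot-⟨⟩ y z)) ⟩
  dot x z - dot y z                                    ∎
  where
    open ≡-Reasoning
    distrib : ∀ a b c → (a - b) * c ≡ a * c - b * c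
    distrib = solve-∀

sumV-+ᵥ : ∀ (x y : V) → sumV (x +ᵥ y) ≡ sumV x + sumV y
sumV-+ᵥ x y = begin
  sumV (x +ᵥ y)                  ≡⟨ foldr′-sum (x +ᵥ y) ⟩
  sum (lookup (x +ᵥ y))          ≡⟨ sum-cong-≗ (lookup-+ᵥ x y) ⟩
  ∑[ i < 8 ] (lookup x i + lookup y i) ≡⟨ ∑-distrib-+ (lookup x) (lookup y) ⟩
  sum (lookup x) + sum (lookup y) ≡⟨ sym (cong₂ _+_ (foldr′-sum x) (foldr′-sum y)) ⟩
  sumV x + sumV y                ∎
  where open ≡-Reasoning

sumV-·ᵥ : ∀ c (x : V) → sumV (c ·ᵥ x) ≡ c * sumV x
sumV-·ᵥ c x = begin
  sumV (c ·ᵥ x)               ≡⟨ foldr′-sum (c ·ᵥ x) ⟩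
  sum (lookup (c ·ᵥ x))       ≡⟨ sum-cong-≗ (lookup-·ᵥ c x) ⟩
  ∑[ i < 8 ] (c * lookup x i) ≡⟨ sum-*ˡ c (lookup x) ⟩
  c * sum (lookup x)          ≡⟨ cong (c *_) (sym (foldr′-sum x)) ⟩
  c * sumV x                  ∎
  where open ≡-Reasoning

-- Normal form of membership in Λ: all coordinates are congruent to one
-- integer ε modulo 2 (ε = 0 or −1 in the definition of InΛ), and 4 ∣ Σ xᵢ.
-- Unlike InΛ it needs no case distinction, so closure properties are uniform.
record ΛForm (x : V) : Set where
  field
    ε             : ℤ
    congruent     : ∀ i → + 2 ∣ lookup x i - ε
    sum-divisible : + 4 ∣ sumV x

toΛForm : ∀ x → InΛ x → ΛForm x
toΛForm x (inj₁ even , 4∣Σ) = record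
  { ε = + 0
  ; congruent = λ i → subst (+ 2 ∣_) (sym (ℤP.+-identityʳ (lookup x i))) (∣ᵤ⇒∣ (even i))
  ; sum-divisible = ∣ᵤ⇒∣ 4∣Σ }
toΛForm x (inj₂ odd , 4∣Σ) = record
  { ε = -[1+ 0 ]
  ; congruent = λ i → ∣ᵤ⇒∣ (odd i)
  ; sum-divisible = ∣ᵤ⇒∣ 4∣Σ }

fromΛForm : ∀ x → ΛForm x → InΛ x
fromΛForm x form = coordinates (parity ε) , ∣⇒∣ᵤ sum-divisible
  where
    open ΛForm form
    coordinates : + 2 ∣ ε ⊎ + 2 ∣ ε + + 1 → _
    coordinates (inj₁ 2∣ε) = inj₁ λ i →
      ∣⇒∣ᵤ (subst (+ 2 ∣_) (cancel (lookup x i) ε) (∣m∣n⇒∣m+n (congruent i) 2∣ε))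
      where cancel : ∀ a ε → a - ε + ε ≡ a
            cancel = solve-∀
    coordinates (inj₂ 2∣ε+1) = inj₂ λ i →
      ∣⇒∣ᵤ (subst (+ 2 ∣_) (cancel (lookup x i) ε) (∣m∣n⇒∣m+n (congruent i) 2∣ε+1))
      where cancel : ∀ a ε → a - ε + (ε + + 1) ≡ a + + 1
            cancel = solve-∀

ΛForm-0ᵥ : ΛForm 0ᵥ
ΛForm-0ᵥ = record
  { ε = + 0
  ; congruent = λ i → subst (λ a → + 2 ∣ a - + 0) (sym (lookup-0ᵥ i)) (divides (+ 0) refl)
  ; sum-divisible = divides (+ 0) refl }

ΛForm-+ᵥ : ∀ {x y} → ΛForm x → ΛForm y → ΛForm (x +ᵥ y)
ΛForm-+ᵥ {x} {y} fx fy = record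
  { ε = X.ε + Y.ε
  ; congruent = λ i → subst (+ 2 ∣_) (regroup (lookup x i) (lookup y i) X.ε Y.ε (sym (lookup-+ᵥ x y i)))
                               (∣m∣n⇒∣m+n (X.congruent i) (Y.congruent i))
  ; sum-divisible = subst (+ 4 ∣_) (sym (sumV-+ᵥ x y)) (∣m∣n⇒∣m+n X.sum-divisible Y.sum-divisible) }
  where
    module X = ΛForm fx
    module Y = ΛForm fy
    regroup : ∀ a b ε δ {s} → a + b ≡ s → a - ε + (b - δ) ≡ s - (ε + δ)
    regroup a b ε δ refl = ring a b ε δ
      where ring : ∀ a b ε δ → a - ε + (b - δ) ≡ a + b - (ε + δ)
            ring = solve-∀

ΛForm-·ᵥ : ∀ c {x} → ΛForm x → ΛForm (c ·ᵥ x)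
ΛForm-·ᵥ c {x} fx = record
  { ε = c * X.ε
  ; congruent = λ i → subst (+ 2 ∣_) (scale c (lookup x i) X.ε (sym (lookup-·ᵥ c x i))) (∣n⇒∣m*n c (X.congruent i))
  ; sum-divisible = subst (+ 4 ∣_) (sym (sumV-·ᵥ c x)) (∣n⇒∣m*n c X.sum-divisible) }
  where
    module X = ΛForm fx
    scale : ∀ c a ε {s} → c * a ≡ s → c * (a - ε) ≡ s - c * ε
    scale c a ε refl = ring c a ε
      where ring : ∀ c a ε → c * (a - ε) ≡ c * a - c * ε
            ring = solve-∀

Λ-·ᵥ : ∀ c x → InΛ x → InΛ (c ·ᵥ x)
Λ-·ᵥ c x hx = fromΛForm (c ·ᵥ x) (ΛForm-·ᵥ c (toΛForm x hx))

Λ-lincomb : ∀ c e → (∀ j → InΛ (e j)) → InΛ (lincomb c e)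
Λ-lincomb c e eΛ = fromΛForm (lincomb c e) (fold (λ i → c i ·ᵥ e i) (λ j → ΛForm-·ᵥ (c j) (toΛForm (e j) (eΛ j))))
  where
    fold : ∀ {m} (g : Fin m → V) → (∀ j → ΛForm (g j)) → ΛForm (foldr′ _+ᵥ_ 0ᵥ (tabulate g))
    fold {ℕ.zero} g _ = ΛForm-0ᵥ
    fold {ℕ.suc m} g gΛ = ΛForm-+ᵥ (gΛ zero) (fold (g ∘ suc) (gΛ ∘ suc))

-- Λ is 3-saturated: if 3y ∈ Λ then y ∈ Λ (3 is prime to 2 and 4)
Λ-divide-3 : ∀ y → InΛ ((+ 3) ·ᵥ y) → InΛ y
Λ-divide-3 y h = fromΛForm y (record
  { ε = ε
  ; congruent = λ i → subst (+ 2 ∣_) (peel (lookup y i) ε)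
                        (∣m∣n⇒∣m-n (subst (λ a → + 2 ∣ a - ε) (lookup-·ᵥ (+ 3) y i) (congruent i))
                                    (divides (lookup y i) (ℤP.*-comm (+ 2) (lookup y i))))
  ; sum-divisible = subst (+ 4 ∣_) (peel′ (sumV y))
                      (∣m∣n⇒∣m-n (∣n⇒∣m*n (+ 3) (subst (+ 4 ∣_) (sumV-·ᵥ (+ 3) y) sum-divisible))
                                  (divides (+ 2 * sumV y) (ring-8 (sumV y)))) })
  where
    open ΛForm (toΛForm ((+ 3) ·ᵥ y) h)
    peel : ∀ a ε → + 3 * a - ε - + 2 * a ≡ a - ε
    peel = solve-∀
    peel′ : ∀ s → + 3 * (+ 3 * s) - + 8 * s ≡ s
    peel′ = solve-∀
    ring-8 : ∀ s → + 8 * s ≡ + 2 * s * + 4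
    ring-8 = solve-∀

-- Λ is integral: a·b ∈ ℤ for a, b ∈ Λ, i.e. 4 ∣ dot x y.
-- With xᵢ ≡ ε and yᵢ ≡ δ (mod 2), xᵢyᵢ = (xᵢ − ε)(yᵢ − δ) + δxᵢ + εyᵢ − εδ,
-- where 4 divides the first term and the sums of the others.
Λ-integral : ∀ x y → InΛ x → InΛ y → + 4 ∣ dot x y
Λ-integral x y hx hy = subst (+ 4 ∣_) (sym expand)
  (∣m∣n⇒∣m+n (∣-sum P (λ i → product (X.congruent i) (Y.congruent i)))
  (∣m∣n⇒∣m+n (∣n⇒∣m*n Y.ε (Σ-divisible x X.sum-divisible))
  (∣m∣n⇒∣m+n (∣n⇒∣m*n X.ε (Σ-divisible y Y.sum-divisible))
             (divides (+ 2 * κ) (eight κ)))))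
  where
    module X = ΛForm (toΛForm x hx)
    module Y = ΛForm (toΛForm y hy)
    κ : ℤ
    κ = - (X.ε * Y.ε)
    a b P R : Fin 8 → ℤ
    a = lookup x
    b = lookup y
    P i = (a i - X.ε) * (b i - Y.ε)
    R i = Y.ε * a i + (X.ε * b i + κ)
    product : ∀ {s t} → + 2 ∣ s → + 2 ∣ t → + 4 ∣ s * t
    product (divides p refl) (divides q refl) = divides (p * q) (ring p q)
      where ring : ∀ p q → p * + 2 * (q * + 2) ≡ p * q * + 4
            ring = solve-∀
    Σ-divisible : ∀ z → + 4 ∣ sumV z → + 4 ∣ sum (lookup z)
    Σ-divisible z = subst (+ 4 ∣_) (foldr′-sum z)
    eight : ∀ s → + 8 * s ≡ + 2 * s * + 4
    eight = solve-∀
    pointwise : ∀ s t ε δ → s * t ≡ (s - ε) * (t - δ) + (δ * s + (ε * t + - (ε * δ)))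
    pointwise = solve-∀
    expand : dot x y ≡ sum P + (Y.ε * sum a + (X.ε * sum b + + 8 * κ))
    expand = begin
      dot x y                                             ≡⟨ dot-⟨⟩ x y ⟩
      ∑[ i < 8 ] (a i * b i)                              ≡⟨ sum-cong-≗ (λ i → pointwise (a i) (b i) X.ε Y.ε) ⟩
      ∑[ i < 8 ] (P i + R i)                              ≡⟨ ∑-distrib-+ P R ⟩
      sum P + sum R                                       ≡⟨ cong (_+_ (sum P)) (trans (∑-distrib-+ (λ i → Y.ε * a i) (λ i → X.ε * b i + κ))
                                                               (cong₂ _+_ (sum-*ˡ Y.ε a) (trans (∑-distrib-+ (λ i → X.ε * b i) (λ _ → κ))
                                                                 (cong₂ _+_ (sum-*ˡ X.ε b) (sum-const {8} κ))))) ⟩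
      sum P + (Y.ε * sum a + (X.ε * sum b + + 8 * κ))     ∎
      where open ≡-Reasoning

module GramIJ (e : Fin 8 → V)
              (norm : ∀ j → dot (e j) (e j) ≡ + 8)
              (angle : ∀ i j → i ≢ j → dot (e i) (e j) ≡ + 4) where

  gram-sum : ∀ c m → ∑[ j < 8 ] (c j * dot (e j) (e m)) ≡ + 4 * sum c + + 4 * c m
  gram-sum c m = begin
    ∑[ j < 8 ] (c j * dot (e j) (e m))
      ≡⟨ sum-remove {i = m} (λ j → c j * dot (e j) (e m)) ⟩
    c m * dot (e m) (e m) + ∑[ i < 7 ] (c (punchIn m i) * dot (e (punchIn m i)) (e m))
      ≡⟨ cong₂ _+_ (cong (c m *_) (norm m))
                   (trans (sum-cong-≗ (λ i → cong (c (punchIn m i) *_) (angle (punchIn m i) m (punchInᵢ≢i m i))))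
                          (sum-*ʳ (+ 4) (c ∘ punchIn m))) ⟩
    c m * + 8 + sum (c ∘ punchIn m) * + 4
      ≡⟨ regroup (c m) (sum (c ∘ punchIn m)) ⟩
    + 4 * (c m + sum (c ∘ punchIn m)) + + 4 * c m
      ≡⟨ cong (λ s → + 4 * s + + 4 * c m) (sym (sum-remove {i = m} c)) ⟩
    + 4 * sum c + + 4 * c m ∎
    where
      open ≡-Reasoning
      regroup : ∀ a s → a * + 8 + s * + 4 ≡ + 4 * (a + s) + + 4 * a
      regroup = solve-∀

  dot-lincomb-e : ∀ c m → dot (lincomb c e) (e m) ≡ + 4 * sum c + + 4 * c m
  dot-lincomb-e c m = trans (dot-lincomb c e (e m)) (gram-sum c m)

  nondegenerate : NondegenerateGram (lookup ∘ e)
  nondegenerate c h = I+J-nondegenerate c λ m →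
    ℤP.*-cancelˡ-≡ (+ 4) (sum c + c m) (+ 0) (begin
      + 4 * (sum c + c m)                                ≡⟨ ℤP.*-distribˡ-+ (+ 4) (sum c) (c m) ⟩
      + 4 * sum c + + 4 * c m                            ≡⟨ sym (gram-sum c m) ⟩
      ∑[ j < 8 ] (c j * dot (e j) (e m))                 ≡⟨ sum-cong-≗ (λ j → cong (c j *_) (dot-⟨⟩ (e j) (e m))) ⟩
      ∑[ j < 8 ] (c j * ⟨ lookup (e j) , lookup (e m) ⟩) ≡⟨ h m ⟩
      + 0                                                ∎)
    where open ≡-Reasoning

  determined : ∀ x y → (∀ m → dot x (e m) ≡ dot y (e m)) → x ≡ y
  determined x y same = vext λ k →
    ℤP.i-j≡0⇒i≡j _ _ (trans (sym (lookup--ᵥ x y k))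
                            (orthogonal⇒zero (lookup ∘ e) nondegenerate (lookup (x -ᵥ y)) orthogonal k))
    where
      orthogonal : ∀ m → ⟨ lookup (x -ᵥ y) , lookup (e m) ⟩ ≡ + 0
      orthogonal m = begin
        ⟨ lookup (x -ᵥ y) , lookup (e m) ⟩ ≡⟨ sym (dot-⟨⟩ (x -ᵥ y) (e m)) ⟩
        dot (x -ᵥ y) (e m)                 ≡⟨ dot--ᵥ x y (e m) ⟩
        dot x (e m) - dot y (e m)          ≡⟨ cong (_- dot y (e m)) (same m) ⟩
        dot y (e m) - dot y (e m)          ≡⟨ ℤP.+-inverseʳ (dot y (e m)) ⟩
        + 0                                ∎
        where open ≡-Reasoning

  -- coordinates of x in the dual basis, scaled by 36:
  -- the Gram matrix 4(I + J) has inverse (9I − J)/36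
  dual : V → Fin 8 → ℤ
  dual x j = + 9 * dot x (e j) - ∑[ i < 8 ] dot x (e i)

  dual-basis : ∀ x → (+ 36) ·ᵥ x ≡ lincomb (dual x) e
  dual-basis x = determined ((+ 36) ·ᵥ x) (lincomb (dual x) e) λ m → begin
    dot ((+ 36) ·ᵥ x) (e m)                   ≡⟨ dot-·ᵥ (+ 36) x (e m) ⟩
    + 36 * dot x (e m)                        ≡⟨ invert (dot x (e m)) D ⟩
    + 4 * (+ 9 * D - + 8 * D) + + 4 * dual x m ≡⟨ cong (λ s → + 4 * s + + 4 * dual x m) (sym sum-dual) ⟩
    + 4 * sum (dual x) + + 4 * dual x m       ≡⟨ sym (dot-lincomb-e (dual x) m) ⟩
    dot (lincomb (dual x) e) (e m)            ∎
    where
      open ≡-Reasoning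
      D : ℤ
      D = ∑[ i < 8 ] dot x (e i)
      invert : ∀ a D → + 36 * a ≡ + 4 * (+ 9 * D - + 8 * D) + + 4 * (+ 9 * a - D)
      invert = solve-∀
      sum-dual : sum (dual x) ≡ + 9 * D - + 8 * D
      sum-dual = trans (sum-- (λ j → + 9 * dot x (e j)) (λ _ → D))
                       (cong₂ _-_ (sum-*ˡ (+ 9) (λ j → dot x (e j))) (sum-const {8} D))

  σ : Fin 8 → ℤ
  σ a = ∑[ j < 8 ] lookup (e j) a

  Q : Fin 8 → ℤ
  Q a = ∑[ j < 8 ] (lookup (e j) a * lookup (e j) a)

  -- the a-th coordinate of the dual-basis identity for the standard basis
  -- vector δₐ, whose inner product with eⱼ is (eⱼ)ₐ
  column-identity : ∀ a → + 36 * + 1 ≡ + 9 * Q a - σ a * σ a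
  column-identity a = begin
    + 36 * + 1                                     ≡⟨ cong (+ 36 *_) (sym (trans (VecP.lookup∘tabulate δ a) (insertAt-lookup (λ _ → + 0) a (+ 1)))) ⟩
    + 36 * lookup δₐ a                             ≡⟨ sym (lookup-·ᵥ (+ 36) δₐ a) ⟩
    lookup ((+ 36) ·ᵥ δₐ) a                        ≡⟨ cong (λ v → lookup v a) (dual-basis δₐ) ⟩
    lookup (lincomb (dual δₐ) e) a                 ≡⟨ lookup-lincomb (dual δₐ) e a ⟩
    ∑[ j < 8 ] (dual δₐ j * E j)                   ≡⟨ sum-cong-≗ (λ j → cong₂ (λ u v → (+ 9 * u - v) * E j) (pair j) (sum-cong-≗ pair)) ⟩
    ∑[ j < 8 ] ((+ 9 * E j - σ a) * E j)           ≡⟨ sum-cong-≗ (λ j → expand (E j) (σ a)) ⟩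
    ∑[ j < 8 ] (+ 9 * (E j * E j) - σ a * E j)     ≡⟨ sum-- (λ j → + 9 * (E j * E j)) (λ j → σ a * E j) ⟩
    sum (λ j → + 9 * (E j * E j)) - sum (λ j → σ a * E j) ≡⟨ cong₂ _-_ (sum-*ˡ (+ 9) (λ j → E j * E j)) (sum-*ˡ (σ a) E) ⟩
    + 9 * Q a - σ a * σ a                          ∎
    where
      open ≡-Reasoning
      δ : Fin 8 → ℤ
      δ = insertAt (λ _ → + 0) a (+ 1)
      δₐ : V
      δₐ = tabulate δ
      E : Fin 8 → ℤ
      E j = lookup (e j) a
      pair : ∀ j → dot δₐ (e j) ≡ E j
      pair j = trans (dot-⟨⟩ δₐ (e j))
                     (trans (sum-cong-≗ (λ k → cong (_* lookup (e j) k) (VecP.lookup∘tabulate δ k))) (⟨basis⟩ a (lookup (e j))))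
      expand : ∀ x s → (+ 9 * x - s) * x ≡ + 9 * (x * x) - s * x
      expand = solve-∀

  -- by column-identity σₐ² = 9(Qₐ − 4), so the prime 3 divides σₐ
  column-divisible : ∀ a → + 3 ∣ σ a
  column-divisible a = prime∣square⇒prime∣ prime-3 (σ a) (divides ((Q a - + 4) * + 3) (begin
    σ a * σ a                         ≡⟨ twice-negate (σ a * σ a) (+ 9 * Q a) ⟩
    + 9 * Q a - (+ 9 * Q a - σ a * σ a) ≡⟨ cong (λ t → + 9 * Q a - t) (sym (column-identity a)) ⟩
    + 9 * Q a - + 36 * + 1            ≡⟨ factor (Q a) ⟩
    (Q a - + 4) * + 3 * + 3           ∎))
    where
      open ≡-Reasoning
      twice-negate : ∀ s t → s ≡ t - (t - s)
      twice-negate = solve-∀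
      factor : ∀ q → + 9 * q - + 36 * + 1 ≡ (q - + 4) * + 3 * + 3
      factor = solve-∀

  T : V
  T = tabulate (λ a → quotient (column-divisible a))

  σ≡3T : ∀ a → σ a ≡ + 3 * lookup T a
  σ≡3T a = trans (_∣_.equality (column-divisible a))
                 (trans (ℤP.*-comm _ (+ 3)) (cong (+ 3 *_) (sym (VecP.lookup∘tabulate (λ a → quotient (column-divisible a)) a))))

  pairing-sum : ∀ x → ∑[ j < 8 ] dot x (e j) ≡ + 3 * dot x T
  pairing-sum x = begin
    ∑[ j < 8 ] dot x (e j)                          ≡⟨ sum-cong-≗ (λ j → dot-⟨⟩ x (e j)) ⟩
    ∑[ j < 8 ] ∑[ k < 8 ] (lookup x k * lookup (e j) k) ≡⟨ ∑-comm (λ j k → lookup x k * lookup (e j) k) ⟩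
    ∑[ k < 8 ] ∑[ j < 8 ] (lookup x k * lookup (e j) k) ≡⟨ sum-cong-≗ (λ k → sum-*ˡ (lookup x k) (λ j → lookup (e j) k)) ⟩
    ∑[ k < 8 ] (lookup x k * σ k)                   ≡⟨ sum-cong-≗ (λ k → trans (cong (lookup x k *_) (σ≡3T k)) (swap (lookup x k) _)) ⟩
    ∑[ k < 8 ] (+ 3 * (lookup x k * lookup T k))    ≡⟨ sum-*ˡ (+ 3) (λ k → lookup x k * lookup T k) ⟩
    + 3 * ⟨ lookup x , lookup T ⟩                   ≡⟨ cong (+ 3 *_) (sym (dot-⟨⟩ x T)) ⟩
    + 3 * dot x T                                   ∎
    where
      open ≡-Reasoning
      swap : ∀ a t → a * (+ 3 * t) ≡ + 3 * (a * t)
      swap = solve-∀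

  dot-e-T : ∀ m → dot (e m) T ≡ + 12
  dot-e-T m = ℤP.*-cancelˡ-≡ (+ 3) (dot (e m) T) (+ 12) (begin
    + 3 * dot (e m) T                       ≡⟨ sym (pairing-sum (e m)) ⟩
    ∑[ j < 8 ] dot (e m) (e j)              ≡⟨ sum-cong-≗ (λ j → trans (dot-comm (e m) (e j)) (sym (ℤP.*-identityˡ _))) ⟩
    ∑[ j < 8 ] (+ 1 * dot (e j) (e m))      ≡⟨ gram-sum (λ _ → + 1) m ⟩
    + 4 * ∑[ j < 8 ] (+ 1) + + 4 * + 1      ≡⟨ cong (λ s → + 4 * s + + 4 * + 1) (sum-const {8} (+ 1)) ⟩
    + 3 * + 12                              ∎)
    where open ≡-Reasoning

  dot-T-T : dot T T ≡ + 32
  dot-T-T = ℤP.*-cancelˡ-≡ (+ 3) (dot T T) (+ 32) (begin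
    + 3 * dot T T                 ≡⟨ sym (pairing-sum T) ⟩
    ∑[ j < 8 ] dot T (e j)        ≡⟨ sum-cong-≗ (λ j → trans (dot-comm T (e j)) (dot-e-T j)) ⟩
    ∑[ j < 8 ] (+ 12)             ≡⟨ sum-const {8} (+ 12) ⟩
    + 3 * + 32                    ∎)
    where open ≡-Reasoning

module FamilyU (e : Fin 8 → V) (hU : InU e) where

  eΛ : ∀ j → InΛ (e j)
  eΛ j = proj₁ (proj₁ hU j)

  open GramIJ e (λ j → proj₂ (proj₁ hU j)) (proj₂ hU)

  span⊆Λ : SubsetΛ (Span e)
  span⊆Λ x (c , refl) = Λ-lincomb c e eΛ

  -- 3T = e₁ + ⋯ + e₈ lies in Λ, hence so does T
  TΛ : InΛ T
  TΛ = Λ-divide-3 T (subst InΛ (sym 3T≡Σe) (Λ-lincomb (λ _ → + 1) e eΛ))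
    where
      3T≡Σe : (+ 3) ·ᵥ T ≡ lincomb (λ _ → + 1) e
      3T≡Σe = vext λ a → begin
        lookup ((+ 3) ·ᵥ T) a                 ≡⟨ lookup-·ᵥ (+ 3) T a ⟩
        + 3 * lookup T a                      ≡⟨ sym (σ≡3T a) ⟩
        σ a                                   ≡⟨ sum-cong-≗ (λ j → sym (ℤP.*-identityˡ (lookup (e j) a))) ⟩
        combination (λ _ → + 1) (lookup ∘ e) a ≡⟨ sym (lookup-lincomb (λ _ → + 1) e a) ⟩
        lookup (lincomb (λ _ → + 1) e) a      ∎
        where open ≡-Reasoning

  r : Fin 3 → V
  r i = (+ toℕ i) ·ᵥ T

  -- With bⱼ = x·eⱼ and q = x·T
  -- (integers since Λ is integral) one has Σ bⱼ = 3q; choosing i with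
  -- q + i = 3m, the vectors x − iT and Σ (bⱼ − m)eⱼ have equal inner
  -- products with every eₘ, so they coincide.
  complete : ∀ x → InΛ x → ∃ λ i → Span e (x -ᵥ r i)
  complete x hx = from-residue (complement-mod q 3)
    where
      b : Fin 8 → ℤ
      b j = quotient (Λ-integral x (e j) hx (eΛ j))
      b-spec : ∀ j → dot x (e j) ≡ b j * + 4
      b-spec j = _∣_.equality (Λ-integral x (e j) hx (eΛ j))
      q : ℤ
      q = quotient (Λ-integral x T hx TΛ)
      Σb≡3q : sum b ≡ + 3 * q
      Σb≡3q = ℤP.*-cancelʳ-≡ (sum b) (+ 3 * q) (+ 4) (begin
        sum b * + 4                 ≡⟨ sym (sum-*ʳ (+ 4) b) ⟩
        ∑[ j < 8 ] (b j * + 4)      ≡⟨ sym (sum-cong-≗ b-spec) ⟩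
        ∑[ j < 8 ] dot x (e j)      ≡⟨ pairing-sum x ⟩
        + 3 * dot x T               ≡⟨ cong (+ 3 *_) (_∣_.equality (Λ-integral x T hx TΛ)) ⟩
        + 3 * (q * + 4)             ≡⟨ sym (ℤP.*-assoc (+ 3) q (+ 4)) ⟩
        + 3 * q * + 4               ∎)
        where open ≡-Reasoning
      -- the inner products of x − iT and of Σ (bⱼ − m)eⱼ with eₙ agree once q + i = 3m
      close : ∀ b q i m → q + i ≡ m * + 3 → b * + 4 - i * + 12 ≡ + 4 * (+ 3 * q - + 8 * m) + + 4 * (b - m)
      close b q i m h = begin
        b * + 4 - i * + 12                       ≡⟨ insert b q i ⟩
        b * + 4 + + 12 * q - (q + i) * + 12      ≡⟨ cong (λ t → b * + 4 + + 12 * q - t * + 12) h ⟩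
        b * + 4 + + 12 * q - m * + 3 * + 12      ≡⟨ collect b q m ⟩
        + 4 * (+ 3 * q - + 8 * m) + + 4 * (b - m) ∎
        where
          open ≡-Reasoning
          insert : ∀ b q i → b * + 4 - i * + 12 ≡ b * + 4 + + 12 * q - (q + i) * + 12
          insert = solve-∀
          collect : ∀ b q m → b * + 4 + + 12 * q - m * + 3 * + 12 ≡ + 4 * (+ 3 * q - + 8 * m) + + 4 * (b - m)
          collect = solve-∀
      from-residue : Σ (Fin 3) (λ i → + 3 ∣ q + + toℕ i) → ∃ λ i → Span e (x -ᵥ r i)
      from-residue (i , divides m q+i≡3m) = i , (λ j → b j - m) , determined (x -ᵥ r i) (lincomb (λ j → b j - m) e) pairings
        where
          pairings : ∀ n → dot (x -ᵥ r i) (e n) ≡ dot (lincomb (λ j → b j - m) e) (e n)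
          pairings n = begin
            dot (x -ᵥ r i) (e n)                       ≡⟨ dot--ᵥ x (r i) (e n) ⟩
            dot x (e n) - dot (r i) (e n)              ≡⟨ cong₂ _-_ (b-spec n) (trans (dot-·ᵥ (+ toℕ i) T (e n))
                                                                      (cong (+ toℕ i *_) (trans (dot-comm T (e n)) (dot-e-T n)))) ⟩
            b n * + 4 - + toℕ i * + 12                 ≡⟨ close (b n) q (+ toℕ i) m q+i≡3m ⟩
            + 4 * (+ 3 * q - + 8 * m) + + 4 * (b n - m) ≡⟨ cong (λ s → + 4 * s + + 4 * (b n - m))
                                                                (sym (trans (sum-- b (λ _ → m)) (cong₂ _-_ Σb≡3q (sum-const {8} m)))) ⟩
            + 4 * ∑[ j < 8 ] (b j - m) + + 4 * (b n - m) ≡⟨ sym (dot-lincomb-e (λ j → b j - m) n) ⟩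
            dot (lincomb (λ j → b j - m) e) (e n)      ∎
            where open ≡-Reasoning

  -- If dT lies in the span, pairing with T gives 32d = 12·Σcⱼ; so 3 ∣ 32d, and 3 ∣ d.
  multiple-of-T-in-span : ∀ d → Span e (d ·ᵥ T) → + 3 ∣ d
  multiple-of-T-in-span d (c , dT≡Σce) =
    subst (+ 3 ∣_) (33-32 d) (∣m∣n⇒∣m-n (divides (d * + 11) (ring-33 d)) (divides (sum c * + 4) 32d≡12Σc))
    where
      open ≡-Reasoning
      33-32 : ∀ d → d * + 33 - d * + 32 ≡ d
      33-32 = solve-∀
      ring-33 : ∀ d → d * + 33 ≡ d * + 11 * + 3
      ring-33 = solve-∀
      32d≡12Σc : d * + 32 ≡ sum c * + 4 * + 3
      32d≡12Σc = begin
        d * + 32                          ≡⟨ cong (d *_) (sym dot-T-T) ⟩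
        d * dot T T                       ≡⟨ sym (dot-·ᵥ d T T) ⟩
        dot (d ·ᵥ T) T                    ≡⟨ cong (λ v → dot v T) dT≡Σce ⟩
        dot (lincomb c e) T               ≡⟨ dot-lincomb c e T ⟩
        ∑[ j < 8 ] (c j * dot (e j) T)    ≡⟨ sum-cong-≗ (λ j → cong (c j *_) (dot-e-T j)) ⟩
        ∑[ j < 8 ] (c j * + 12)           ≡⟨ sum-*ʳ (+ 12) c ⟩
        sum c * + 12                      ≡⟨ ℤP.*-assoc (sum c) (+ 4) (+ 3) ⟨
        sum c * + 4 * + 3                 ∎

  incongruent : ∀ i j → Span e (r i -ᵥ r j) → i ≡ j
  incongruent i j s = incongruent-mod-3 i j (multiple-of-T-in-span (+ toℕ i - + toℕ j) (subst (Span e) difference s))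
    where
      difference : r i -ᵥ r j ≡ (+ toℕ i - + toℕ j) ·ᵥ T
      difference = vext λ k → begin
        lookup (r i -ᵥ r j) k                         ≡⟨ lookup--ᵥ (r i) (r j) k ⟩
        lookup (r i) k - lookup (r j) k               ≡⟨ cong₂ _-_ (lookup-·ᵥ (+ toℕ i) T k) (lookup-·ᵥ (+ toℕ j) T k) ⟩
        + toℕ i * lookup T k - + toℕ j * lookup T k   ≡⟨ factor (+ toℕ i) (+ toℕ j) (lookup T k) ⟩
        (+ toℕ i - + toℕ j) * lookup T k              ≡⟨ sym (lookup-·ᵥ (+ toℕ i - + toℕ j) T k) ⟩
        lookup ((+ toℕ i - + toℕ j) ·ᵥ T) k           ∎
        where
          open ≡-Reasoning
          factor : ∀ a b t → a * t - b * t ≡ (a - b) * t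
          factor = solve-∀

  index-3 : HasIndex (Span e) 3
  index-3 = r , (λ i → Λ-·ᵥ (+ toℕ i) T TΛ) , complete , incongruent

  -- An automorphism fixing every eⱼ is the identity: g x and x have the
  -- same inner products with every eₘ = g eₘ, since g is an isometry.
  free : (g : Aut) → Fixes g e → IsId g
  free g fixes x hx = determined (f g x) x λ m →
    trans (cong (dot (f g x)) (sym (fixes m))) (isom g x (e m) hx (eΛ m))

lemma3p3 : ((e : Fin 8 → V) → InU e → SubsetΛ (Span e) × HasIndex (Span e) 3)
         × ((g : Aut) (e : Fin 8 → V) → InU e → Fixes g e → IsId g)
lemma3p3 = (λ e hU → FamilyU.span⊆Λ e hU , FamilyU.index-3 e hU)
         , (λ g e hU → FamilyU.free e hU g)
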